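{- The integer $52$ is not prime partitionable (in the sense defined in the context below).
   Context: An integer $n$ is called prime partitionable if there is a partition $\{\mathbb{P}_1,\mathbb{P}_2\}$ of the set of all primes less than $n$ into two nonempty disjoint sets such that for all positive integers $n_1,n_2$ with $n_1+n_2=n$ there is some pair $(p_1,p_2)\in\mathbb{P}_1\times\mathbb{P}_2$ with $\gcd(n_1,p_1)>1$ or $\gcd(n_2,p_2)>1$ (equivalently: some $p_1\in\mathbb{P}_1$ divides $n_1$ or some $p_2\in\mathbb{P}_2$ divides $n_2$). -}

module Defs where

open import Data.Nat using (ℕ; suc; _+_; _<_)
open import Data.Nat.Divisibility using (_∣_)
open import Data.Nat.Primality using (Prime)
open import Data.Bool using (Bool; true; false)
open import Data.Product using (Σ; _×_; ∃-syntax)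
open import Data.Sum using (_⊎_)
open import Relation.Binary.PropositionalEquality using (_≡_)

-- A 2-colouring of the naturals; restricted to the primes below n it describes
-- the partition {P₁, P₂}: P₁ = primes p < n with c p ≡ true,
--                       P₂ = primes p < n with c p ≡ false.
InP₁ : (n : ℕ) → (ℕ → Bool) → ℕ → Set
InP₁ n c p = Prime p × p < n × c p ≡ true

InP₂ : (n : ℕ) → (ℕ → Bool) → ℕ → Set
InP₂ n c p = Prime p × p < n × c p ≡ false

IsPrimePartition : ℕ → (ℕ → Bool) → Set
IsPrimePartition n c =
  (∃[ p ] InP₁ n c p) × (∃[ p ] InP₂ n c p) ×
  ((n₁ n₂ : ℕ) → 1 Data.Nat.≤ n₁ → 1 Data.Nat.≤ n₂ → n₁ + n₂ ≡ n →
     (∃[ p₁ ] (InP₁ n c p₁ × p₁ ∣ n₁)) ⊎ (∃[ p₂ ] (InP₂ n c p₂ × p₂ ∣ n₂)))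

PrimePartitionable : ℕ → Set
PrimePartitionable n = ∃[ c ] IsPrimePartition n c

-- A partition {P₁, P₂} of the primes below n is given by a colouring c
-- (P₁ = colour true, P₂ = colour false).  It is defeated by an
-- *obstruction*: a decomposition n = a + b in which every prime factor of a
-- lies in P₂ and every prime factor of b lies in P₁.  For then no prime of
-- P₁ divides a and no prime of P₂ divides b, contrary to the defining
-- property.  We record a and b by their prime factorisations, so that "every
-- prime factor of a" is controlled by the library lemma
-- factorisationHasAllPrimeFactors.
--
-- Then, up to that symmetry (c 3 ≡ false), the colours of 5, 7 and 17 force
-- one of  52 = 27 + 25 = 3 + 49 = 51 + 1 = 35 + 17  to be an obstruction.
module Submission where

open import Defs
open import Relation.Nullary using (¬_)
open import Data.Nat using (ℕ; _+_)
open import Data.Nat.Properties using (+-comm)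
open import Data.Nat.Divisibility using (_∣_)
open import Data.Nat.ListAction using (product)
open import Data.Nat.Primality using (Prime; prime?; productOfPrimes≥1)
open import Data.Nat.Primality.Factorisation using (factorisationHasAllPrimeFactors)
open import Data.Bool using (Bool; true; false; not)
open import Data.Bool.Properties using (not-injective)
open import Data.Product using (Σ-syntax; _×_; _,_)
open import Data.Sum using ([_,_]′)
open import Data.List using (List; []; _∷_)
open import Data.List.Relation.Unary.All as All using (All; []; _∷_)
open import Relation.Nullary.Decidable using (from-yes)
open import Relation.Binary.PropositionalEquality using (_≡_; _≢_; refl; sym; trans; cong)
open import Function using (_∘_)

record Obstruction (n : ℕ) (c : ℕ → Bool) : Set where
  constructor obstruction
  field
    left right   : List ℕ
    leftPrimes   : All Prime left
    rightPrimes  : All Prime right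
    leftColours  : All (λ p → c p ≡ false) left
    rightColours : All (λ p → c p ≡ true) right
    sums         : product left + product right ≡ n

-- An obstruction at n shows that c does not induce a prime partition of n:
-- the summand whose prime factors all lie in the other part cannot be hit.
obstruction⇒¬partition : ∀ {n c} → Obstruction n c → ¬ IsPrimePartition n c
obstruction⇒¬partition {n} {c} (obstruction as bs as-prime bs-prime as-false bs-true sums)
  (_ , _ , covering) =
  [ no-P₁-divisor , no-P₂-divisor ]′
    (covering (product as) (product bs)
      (productOfPrimes≥1 as-prime) (productOfPrimes≥1 bs-prime) sums)
  where
  true≢false : true ≢ false
  true≢false ()

  no-P₁-divisor : ¬ (Σ[ p ∈ ℕ ] (InP₁ n c p × p ∣ product as))
  no-P₁-divisor (p , (p-prime , _ , p-true) , p∣a) =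
    true≢false (trans (sym p-true)
      (All.lookup as-false (factorisationHasAllPrimeFactors p-prime p∣a as-prime)))

  no-P₂-divisor : ¬ (Σ[ p ∈ ℕ ] (InP₂ n c p × p ∣ product bs))
  no-P₂-divisor (p , (p-prime , _ , p-false) , p∣b) =
    true≢false (trans
      (sym (All.lookup bs-true (factorisationHasAllPrimeFactors p-prime p∣b bs-prime)))
      p-false)

obstruction-swap : ∀ {n c} → Obstruction n (not ∘ c) → Obstruction n c
obstruction-swap (obstruction as bs as-prime bs-prime as-false bs-true sums) =
  obstruction bs as bs-prime as-prime
    (All.map (not-injective {y = false}) bs-true)
    (All.map (not-injective {y = true}) as-false)
    (trans (+-comm (product bs) (product as)) sums)

prime-3 : Prime 3
prime-3 = from-yes (prime? 3)

prime-5 : Prime 5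
prime-5 = from-yes (prime? 5)

prime-7 : Prime 7
prime-7 = from-yes (prime? 7)

prime-17 : Prime 17
prime-17 = from-yes (prime? 17)

obstruction52-3∈P₂ : ∀ c → c 3 ≡ false → Obstruction 52 c
obstruction52-3∈P₂ c c3 with c 5 in c5 | c 7 in c7 | c 17 in c17
... | true  | _     | _     =
  obstruction (3 ∷ 3 ∷ 3 ∷ []) (5 ∷ 5 ∷ [])
    (prime-3 ∷ prime-3 ∷ prime-3 ∷ []) (prime-5 ∷ prime-5 ∷ [])
    (c3 ∷ c3 ∷ c3 ∷ []) (c5 ∷ c5 ∷ []) refl
... | false | true  | _     =
  obstruction (3 ∷ []) (7 ∷ 7 ∷ [])
    (prime-3 ∷ []) (prime-7 ∷ prime-7 ∷ [])
    (c3 ∷ []) (c7 ∷ c7 ∷ []) refl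
... | false | false | false =
  obstruction (3 ∷ 17 ∷ []) []
    (prime-3 ∷ prime-17 ∷ []) []
    (c3 ∷ c17 ∷ []) [] refl
... | false | false | true  =
  obstruction (5 ∷ 7 ∷ []) (17 ∷ [])
    (prime-5 ∷ prime-7 ∷ []) (prime-17 ∷ [])
    (c5 ∷ c7 ∷ []) (c17 ∷ []) refl

obstruction52 : ∀ c → Obstruction 52 c
obstruction52 c with c 3 in c3
... | false = obstruction52-3∈P₂ c c3
... | true  = obstruction-swap (obstruction52-3∈P₂ (not ∘ c) (cong not c3))

mainTheorem1 : ¬ PrimePartitionable 52
mainTheorem1 (c , partition) = obstruction⇒¬partition (obstruction52 c) partition
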